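{- Let $(A,B)$ be a suitable pair of $k$-tuples with compound sequence $(g_0,\dots,g_k)$. For each integer $n\in\mathbb{Z}$ and each integer $0\le j\le k$, there is a unique expression $n=\sum_{i=0}^k n_ig_i$ with all $n_i\in\mathbb{Z}$, $0\le n_i<b_{i+1}$ for $0\le i<j$ and $0\le n_i<a_i$ for $j<i\le k$. Moreover, $n\in\mathit{NR}(A,B)$ if and only if \[1\le -n_j\le \frac{1}{g_j}\sum_{i\ne j}n_ig_i.\]
   Context: A pair $A=(a_1,\dots,a_k)$, $B=(b_1,\dots,b_k)$ of $k$-tuples of positive integers is suitable if $\gcd(a_i,b_j)=1$ for all $i\ge j$. Its compound sequence is $g_i=b_1\cdots b_ia_{i+1}\cdots a_k$, $0\le i\le k$. $\mathit{NR}(A,B)$ is the set of non-negative integers not expressible as $\sum_i m_ig_i$ with all $m_i\in\mathbb{N}_0$. -}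

module Defs where

open import Data.Nat as ℕ using (ℕ; zero; suc)
open import Data.Nat.Coprimality using (Coprime)
open import Data.Integer as ℤ using (ℤ; +_)
open import Data.Fin as Fin using (Fin; toℕ; inject₁)
open import Data.Fin.Properties using () renaming (_≟_ to _≟ᶠ_)
open import Data.Product using (Σ; ∃; _×_; _,_)
open import Relation.Nullary using (¬_; yes; no)
open import Relation.Nullary.Decidable using (does)
open import Relation.Binary.PropositionalEquality using (_≡_)
open import Function using (_∘_)
open import Data.Bool using (if_then_else_)

sumℤ : ∀ {n} → (Fin n → ℤ) → ℤ
sumℤ {zero}  f = + 0
sumℤ {suc n} f = f Fin.zero ℤ.+ sumℤ (f ∘ Fin.suc)

prodℕ : ∀ {n} → (Fin n → ℕ) → ℕ
prodℕ {zero}  f = 1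
prodℕ {suc n} f = f Fin.zero ℕ.* prodℕ (f ∘ Fin.suc)

-- k-tuples are 0-indexed: a t = a_{t+1}, b t = b_{t+1} for t : Fin k.

Positive : ∀ {k} → (Fin k → ℕ) → Set
Positive a = ∀ t → 0 ℕ.< a t

Suitable : ∀ {k} → (Fin k → ℕ) → (Fin k → ℕ) → Set
Suitable a b = ∀ i j → toℕ j ℕ.≤ toℕ i → Coprime (a i) (b j)

-- compound sequence: g_i = b_1 ⋯ b_i a_{i+1} ⋯ a_k, i : Fin (suc k)
-- (0-based factor t is b t if t < i, else a t)
compound : ∀ {k} → (Fin k → ℕ) → (Fin k → ℕ) → Fin (suc k) → ℕ
compound a b i = prodℕ (λ t → if does (toℕ t ℕ.<? toℕ i) then b t else a t)

Representable : ∀ {m} → (Fin m → ℕ) → ℕ → Set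
Representable g n = Σ (Fin _ → ℕ) λ c → + n ≡ sumℤ (λ i → + c i ℤ.* + g i)

NR : ∀ {k} → (Fin k → ℕ) → (Fin k → ℕ) → ℤ → Set
NR a b n = Σ ℕ λ m → (n ≡ + m) × ¬ Representable (compound a b) m

-- the normalization conditions of the expression, relative to j:
-- 0 ≤ n_i < b_{i+1} for i < j,  0 ≤ n_i < a_i for i > j
Normalized : ∀ {k} → (Fin k → ℕ) → (Fin k → ℕ) → Fin (suc k) → (Fin (suc k) → ℤ) → Set
Normalized {k} a b j c =
  (∀ (t : Fin k) → toℕ t ℕ.< toℕ j → (+ 0 ℤ.≤ c (inject₁ t)) × (c (inject₁ t) ℤ.< + b t))
  × (∀ (t : Fin k) → toℕ j ℕ.≤ toℕ t → (+ 0 ℤ.≤ c (Fin.suc t)) × (c (Fin.suc t) ℤ.< + a t))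

Expresses : ∀ {m} → (Fin m → ℕ) → (Fin m → ℤ) → ℤ → Set
Expresses g c n = n ≡ sumℤ (λ i → c i ℤ.* + g i)

sumExcept : ∀ {m} → (Fin m → ℕ) → (Fin m → ℤ) → Fin m → ℤ
sumExcept g c j = sumℤ (λ i → if does (i ≟ᶠ j) then + 0 else c i ℤ.* + g i)

-- Peeling off the first generator gives g₀ = a₁⋯a_k and g_{i+1} = b₁ g′_i, with g′ the compound
-- sequence of the shifted tuples; peeling off the last gives g_k = b₁⋯b_k and g_i = a_k g″_i
-- (i < k). Suitability makes the peeled generator P coprime to the common factor β of the
-- others, so every integer is x P + β n′ with a unique digit 0 ≤ x < β; the normalized expression
-- relative to j is built digit by digit, from the front while j > 0 and from the back when j = 0.
-- If moreover n = Σ μ_i g_i with all μ_i ≥ 0, the peeled μ exceeds the digit by a nonnegative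
-- multiple of β, which carries into n′ as a nonnegative multiple of a generator of g′ (or g″);
-- inductively, representable n have n_j ≥ 0. Conversely, n_j ≥ 0 makes every coefficient
-- nonnegative. So n ∈ NR iff n ≥ 0 and n_j < 0, which is the stated inequality.
module Submission where

open import Defs
open import Data.Nat as ℕ using (ℕ; suc; zero; z≤n; s≤s; NonZero)
import Data.Nat.Properties as ℕ
open import Data.Nat.Coprimality using (Coprime; coprime-divisor; coprime-Bézout; 1-coprimeTo)
  renaming (sym to coprime-sym)
open import Data.Nat.Divisibility using (∣-trans)
open import Data.Nat.GCD using (module Bézout)
open import Data.Integer as ℤ using (ℤ; +_; -_; _+_; _-_; _*_; _≤_; _<_; +≤+; +<+; -[1+_]; ∣_∣)
import Data.Integer.Properties as ℤ
open import Data.Integer.DivMod using (_%ℕ_; _/ℕ_; n%ℕd<d; a≡a%ℕn+[a/ℕn]*n)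
open import Data.Integer.Tactic.RingSolver using (solve-∀)
open import Data.Fin as Fin using (Fin; toℕ; inject₁; fromℕ) renaming (zero to fzero; suc to fsuc)
import Data.Fin.Properties as Fin
open import Data.Vec.Functional using (_∷_; updateAt; insertAt)
open import Data.Vec.Functional.Properties using (insertAt-lookup)
open import Data.Product using (Σ; _×_; ∃₂; _,_; proj₁; proj₂)
open import Data.Bool using (if_then_else_)
open import Function using (_∘_)
open import Function.Bundles using (_⇔_; mk⇔)
open import Relation.Nullary using (¬_; yes; no; contradiction)
open import Relation.Nullary.Decidable using (does; dec-true; dec-false)
open import Relation.Binary.Definitions using (tri<; tri≈; tri>)
open import Relation.Binary.PropositionalEquality
  using (_≡_; refl; sym; trans; cong; cong₂; subst; subst₂; module ≡-Reasoning)

private variable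
  k m : ℕ

sumℤ-cong : {f h : Fin m → ℤ} → (∀ i → f i ≡ h i) → sumℤ f ≡ sumℤ h
sumℤ-cong {zero}  f≡h = refl
sumℤ-cong {suc m} f≡h = cong₂ _+_ (f≡h fzero) (sumℤ-cong (f≡h ∘ fsuc))

sumℤ-*ˡ : ∀ x (f : Fin m → ℤ) → sumℤ (λ i → x * f i) ≡ x * sumℤ f
sumℤ-*ˡ {zero}  x f = sym (ℤ.*-zeroʳ x)
sumℤ-*ˡ {suc m} x f = trans (cong (_+_ (x * f fzero)) (sumℤ-*ˡ x (f ∘ fsuc)))
                            (sym (ℤ.*-distribˡ-+ x (f fzero) _))

sumℤ-init-last : (f : Fin (suc m) → ℤ) → sumℤ f ≡ sumℤ (f ∘ inject₁) + f (fromℕ m)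
sumℤ-init-last {zero}  f = ℤ.+-comm (f fzero) (+ 0)
sumℤ-init-last {suc m} f = trans (cong (_+_ (f fzero)) (sumℤ-init-last (f ∘ fsuc)))
                                 (sym (ℤ.+-assoc (f fzero) _ _))

sumℤ-remove : (f : Fin m → ℤ) (j : Fin m) →
              sumℤ f ≡ f j + sumℤ (λ i → if does (i Fin.≟ j) then + 0 else f i)
sumℤ-remove f fzero    = cong (_+_ (f fzero)) (sym (ℤ.+-identityˡ _))
sumℤ-remove f (fsuc j) = trans (cong (_+_ (f fzero)) (sumℤ-remove (f ∘ fsuc) j))
                               (swap (f fzero) (f (fsuc j)) _)
  where
  swap : ∀ x y r → x + (y + r) ≡ y + (x + r)
  swap = solve-∀

sumℤ-nonneg : (f : Fin m → ℤ) → (∀ i → + 0 ≤ f i) → + 0 ≤ sumℤ f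
sumℤ-nonneg {zero}  f f≥0 = +≤+ z≤n
sumℤ-nonneg {suc m} f f≥0 = ℤ.+-mono-≤ (f≥0 fzero) (sumℤ-nonneg (f ∘ fsuc) (f≥0 ∘ fsuc))

prodℕ-cong : {f h : Fin m → ℕ} → (∀ i → f i ≡ h i) → prodℕ f ≡ prodℕ h
prodℕ-cong {zero}  f≡h = refl
prodℕ-cong {suc m} f≡h = cong₂ ℕ._*_ (f≡h fzero) (prodℕ-cong (f≡h ∘ fsuc))

prodℕ-init-last : (f : Fin (suc m) → ℕ) → prodℕ f ≡ prodℕ (f ∘ inject₁) ℕ.* f (fromℕ m)
prodℕ-init-last {zero}  f = ℕ.*-comm (f fzero) 1
prodℕ-init-last {suc m} f = trans (cong (f fzero ℕ.*_) (prodℕ-init-last (f ∘ fsuc)))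
                                  (sym (ℕ.*-assoc (f fzero) _ _))

coprime-*ˡ : ∀ {a b n} → Coprime a n → Coprime b n → Coprime (a ℕ.* b) n
coprime-*ˡ a⊥n b⊥n {d} (d∣ab , d∣n) = b⊥n (coprime-divisor d⊥a d∣ab , d∣n)
  where
  d⊥a : Coprime d _
  d⊥a (e∣d , e∣a) = a⊥n (e∣a , ∣-trans e∣d d∣n)

coprime-prodℕ : ∀ {n} (f : Fin m → ℕ) → (∀ i → Coprime (f i) n) → Coprime (prodℕ f) n
coprime-prodℕ {zero}  f f⊥n = 1-coprimeTo _
coprime-prodℕ {suc m} f f⊥n = coprime-*ˡ (f⊥n fzero) (coprime-prodℕ (f ∘ fsuc) (f⊥n ∘ fsuc))

if-<-true : ∀ {m n} {A : Set} {x y : A} → m ℕ.< n → (if does (m ℕ.<? n) then x else y) ≡ x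
if-<-true {m} {n} m<n rewrite dec-true (m ℕ.<? n) m<n = refl

if-<-false : ∀ {m n} {A : Set} {x y : A} → ¬ m ℕ.< n → (if does (m ℕ.<? n) then x else y) ≡ y
if-<-false {m} {n} m≮n rewrite dec-false (m ℕ.<? n) m≮n = refl

toℕ<toℕ-fromℕ : (i : Fin m) → toℕ i ℕ.< toℕ (fromℕ m)
toℕ<toℕ-fromℕ {m} i rewrite Fin.toℕ-fromℕ m = Fin.toℕ<n i

compound-last : (a b : Fin k → ℕ) → compound a b (fromℕ k) ≡ prodℕ b
compound-last a b = prodℕ-cong {h = b} λ t → if-<-true {y = a t} (toℕ<toℕ-fromℕ t)

compound-inject₁ : (a b : Fin (suc k) → ℕ) (i : Fin (suc k)) →
  compound a b (inject₁ i) ≡ compound (a ∘ inject₁) (b ∘ inject₁) i ℕ.* a (fromℕ k)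
compound-inject₁ {k} a b i =
  trans (prodℕ-init-last (factor a b (toℕ (inject₁ i))))
        (cong₂ ℕ._*_ (prodℕ-cong earlier) (if-<-false (ℕ.≤⇒≯ i≤k)))
  where
  factor : (a b : Fin m → ℕ) → ℕ → Fin m → ℕ
  factor a b l t = if does (toℕ t ℕ.<? l) then b t else a t
  earlier : ∀ t → factor a b (toℕ (inject₁ i)) (inject₁ t) ≡ factor (a ∘ inject₁) (b ∘ inject₁) (toℕ i) t
  earlier t = cong₂ (λ u v → if does (u ℕ.<? v) then b (inject₁ t) else a (inject₁ t))
                    (Fin.toℕ-inject₁ t) (Fin.toℕ-inject₁ i)
  i≤k : toℕ (inject₁ i) ℕ.≤ toℕ (fromℕ k)
  i≤k = subst (ℕ._≤ toℕ (fromℕ k)) (sym (Fin.toℕ-inject₁ i)) (Fin.≤fromℕ i)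

prodℕ-last-factor : (a b : Fin (suc k) → ℕ) →
  prodℕ b ≡ b (fromℕ k) ℕ.* compound (a ∘ inject₁) (b ∘ inject₁) (fromℕ k)
prodℕ-last-factor {k} a b = begin
  prodℕ b                                     ≡⟨ prodℕ-init-last b ⟩
  prodℕ (b ∘ inject₁) ℕ.* b (fromℕ k)         ≡⟨ ℕ.*-comm (prodℕ (b ∘ inject₁)) (b (fromℕ k)) ⟩
  b (fromℕ k) ℕ.* prodℕ (b ∘ inject₁)         ≡⟨ cong (b (fromℕ k) ℕ.*_) (compound-last _ (b ∘ inject₁)) ⟨
  b (fromℕ k) ℕ.* compound (a ∘ inject₁) (b ∘ inject₁) (fromℕ k) ∎
  where open ≡-Reasoning

sumℤ-scaled : (c : Fin m → ℤ) (g h : Fin m → ℕ) (β : ℕ) → (∀ i → g i ≡ β ℕ.* h i) →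
  sumℤ (λ i → c i * + g i) ≡ + β * sumℤ (λ i → c i * + h i)
sumℤ-scaled c g h β g≡βh = trans (sumℤ-cong term) (sumℤ-*ˡ (+ β) (λ i → c i * + h i))
  where
  swap : ∀ x y z → x * (y * z) ≡ y * (x * z)
  swap = solve-∀
  term : ∀ i → c i * + g i ≡ + β * (c i * + h i)
  term i = trans (cong (λ w → c i * w) (trans (cong +_ (g≡βh i)) (ℤ.pos-* β (h i))))
                 (swap (c i) (+ β) (+ h i))

sumℤ-compound-head : (a b : Fin (suc k) → ℕ) (c : Fin (suc (suc k)) → ℤ) →
  sumℤ (λ i → c i * + compound a b i)
    ≡ c fzero * + prodℕ a + + b fzero * sumℤ (λ i → c (fsuc i) * + compound (a ∘ fsuc) (b ∘ fsuc) i)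
sumℤ-compound-head a b c =
  cong (_+_ (c fzero * + prodℕ a))
       (sumℤ-scaled (c ∘ fsuc) _ (compound (a ∘ fsuc) (b ∘ fsuc)) (b fzero) (λ _ → refl))

sumℤ-compound-last : (a b : Fin (suc k) → ℕ) (c : Fin (suc (suc k)) → ℤ) →
  sumℤ (λ i → c i * + compound a b i)
    ≡ c (fromℕ (suc k)) * + prodℕ b
      + + a (fromℕ k) * sumℤ (λ i → c (inject₁ i) * + compound (a ∘ inject₁) (b ∘ inject₁) i)
sumℤ-compound-last {k} a b c = begin
  sumℤ (λ i → c i * + compound a b i)
    ≡⟨ sumℤ-init-last (λ i → c i * + compound a b i) ⟩
  sumℤ (λ i → c (inject₁ i) * + compound a b (inject₁ i)) + c (fromℕ (suc k)) * + compound a b (fromℕ (suc k))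
    ≡⟨ ℤ.+-comm (sumℤ (λ i → c (inject₁ i) * + compound a b (inject₁ i))) _ ⟩
  c (fromℕ (suc k)) * + compound a b (fromℕ (suc k)) + sumℤ (λ i → c (inject₁ i) * + compound a b (inject₁ i))
    ≡⟨ cong₂ (λ u v → c (fromℕ (suc k)) * + u + v) (compound-last a b)
             (sumℤ-scaled (c ∘ inject₁) _ (compound (a ∘ inject₁) (b ∘ inject₁)) (a (fromℕ k))
                          (λ i → trans (compound-inject₁ a b i) (ℕ.*-comm (compound (a ∘ inject₁) (b ∘ inject₁) i) _))) ⟩
  c (fromℕ (suc k)) * + prodℕ b
    + + a (fromℕ k) * sumℤ (λ i → c (inject₁ i) * + compound (a ∘ inject₁) (b ∘ inject₁) i) ∎
  where open ≡-Reasoning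

private
  bézout-lift : ∀ x m y n → 1 ℕ.+ y ℕ.* n ≡ x ℕ.* m → + x * + m + - + y * + n ≡ + 1
  bézout-lift x m y n 1+yn≡xm = begin
    + x * + m + - + y * + n         ≡⟨ minus (+ x) (+ m) (+ y) (+ n) ⟩
    + x * + m - + y * + n           ≡⟨ cong₂ _-_ (sym (ℤ.pos-* x m)) (sym (ℤ.pos-* y n)) ⟩
    + (x ℕ.* m) - + (y ℕ.* n)       ≡⟨ cong (λ w → + w - + (y ℕ.* n)) (sym 1+yn≡xm) ⟩
    + (1 ℕ.+ y ℕ.* n) - + (y ℕ.* n) ≡⟨ cong (_- + (y ℕ.* n)) (ℤ.pos-+ 1 (y ℕ.* n)) ⟩
    + 1 + + (y ℕ.* n) - + (y ℕ.* n) ≡⟨ cancel (+ (y ℕ.* n)) ⟩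
    + 1                             ∎
    where
    open ≡-Reasoning
    minus : ∀ x m y n → x * m + - y * n ≡ x * m - y * n
    minus = solve-∀
    cancel : ∀ z → + 1 + z - z ≡ + 1
    cancel = solve-∀

bézoutℤ : ∀ {m n} → Coprime m n → ∃₂ λ u v → u * + m + v * + n ≡ + 1
bézoutℤ {m} {n} m⊥n with coprime-Bézout m⊥n
... | Bézout.+- x y 1+yn≡xm = + x , - + y , bézout-lift x m y n 1+yn≡xm
... | Bézout.-+ x y 1+xm≡yn = - + x , + y ,
      trans (ℤ.+-comm (- + x * + m) (+ y * + n)) (bézout-lift y n x m 1+xm≡yn)

Bounded : ℕ → ℤ → Set
Bounded m x = (+ 0 ≤ x) × (x < + m)

carry-nonneg : ∀ {β x y} q → + 0 ≤ y → x < + β → y ≡ x + q * + β → + 0 ≤ q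
carry-nonneg (+ _) _ _ _ = +≤+ z≤n
carry-nonneg {β} {x} {y} -[1+ r ] 0≤y x<β y≡x+qβ = contradiction β≤x (ℤ.<⇒≱ x<β)
  where
  open ℤ.≤-Reasoning
  cancel : ∀ x z → x + - z + z ≡ x
  cancel = solve-∀
  y+rβ≡x : y + + suc r * + β ≡ x
  y+rβ≡x = begin-equality
    y + + suc r * + β             ≡⟨ cong (_+ + suc r * + β) y≡x+qβ ⟩
    x + -[1+ r ] * + β + + suc r * + β
      ≡⟨ cong (λ w → x + w + + suc r * + β) (sym (ℤ.neg-distribˡ-* (+ suc r) (+ β))) ⟩
    x + - (+ suc r * + β) + + suc r * + β ≡⟨ cancel x (+ suc r * + β) ⟩
    x                             ∎
  β≤x : + β ≤ x
  β≤x = begin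
    + β                       ≤⟨ +≤+ (ℕ.m≤n*m β (suc r)) ⟩
    + (suc r ℕ.* β)           ≡⟨ ℤ.pos-* (suc r) β ⟩
    + suc r * + β             ≡⟨ ℤ.+-identityˡ _ ⟨
    + 0 + + suc r * + β       ≤⟨ ℤ.+-monoˡ-≤ (+ suc r * + β) 0≤y ⟩
    y + + suc r * + β         ≡⟨ y+rβ≡x ⟩
    x                         ∎

nonneg-antisym : ∀ i → + 0 ≤ i → + 0 ≤ - i → i ≡ + 0
nonneg-antisym (+ zero) _ _ = refl
nonneg-antisym (+ suc _) _ ()

module Digits (P β : ℕ) .{{_ : NonZero β}} (P⊥β : Coprime P β) where

  private
    u v : ℤ
    u = proj₁ (bézoutℤ P⊥β)
    v = proj₁ (proj₂ (bézoutℤ P⊥β))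
    uP+vβ≡1 : u * + P + v * + β ≡ + 1
    uP+vβ≡1 = proj₂ (proj₂ (bézoutℤ P⊥β))

  record DigitSplit (n : ℤ) : Set where
    field
      digit    : ℕ
      digit<β  : digit ℕ.< β
      quotient : ℤ
      split    : n ≡ + digit * + P + + β * quotient

  digitSplit : ∀ n → DigitSplit n
  digitSplit n = record
    { digit = r ; digit<β = n%ℕd<d (n * u) β ; quotient = s * + P + n * v ; split = n≡ }
    where
    r = (n * u) %ℕ β
    s = (n * u) /ℕ β
    expand : ∀ n u v P β → n * (u * P + v * β) ≡ (n * u) * P + β * (n * v)
    expand = solve-∀
    regroup : ∀ r s n v P β → (r + s * β) * P + β * (n * v) ≡ r * P + β * (s * P + n * v)
    regroup = solve-∀
    open ≡-Reasoning
    n≡ : n ≡ + r * + P + + β * (s * + P + n * v)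
    n≡ = begin
      n                                      ≡⟨ ℤ.*-identityʳ n ⟨
      n * + 1                                ≡⟨ cong (n *_) uP+vβ≡1 ⟨
      n * (u * + P + v * + β)                ≡⟨ expand n u v (+ P) (+ β) ⟩
      (n * u) * + P + + β * (n * v)          ≡⟨ cong (λ w → w * + P + + β * (n * v)) (a≡a%ℕn+[a/ℕn]*n (n * u) β) ⟩
      (+ r + s * + β) * + P + + β * (n * v)  ≡⟨ regroup (+ r) s n v (+ P) (+ β) ⟩
      + r * + P + + β * (s * + P + n * v)    ∎

  carry : ∀ {x y T T'} → x * + P + + β * T ≡ y * + P + + β * T' →
          Σ ℤ λ q → (y ≡ x + q * + β) × (T ≡ T' + q * + P)
  carry {x} {y} {T} {T'} eq = q , y≡x+qβ , T≡T'+qP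
    where
    open ≡-Reasoning
    -- (y − x) / β, computed with the Bézout coefficients
    q = u * (T - T') + (y - x) * v
    βe≡dP : + β * (T - T') ≡ (y - x) * + P
    βe≡dP = begin
      + β * (T - T')
        ≡⟨ isolate x y T T' (+ P) (+ β) ⟩
      (y - x) * + P + (x * + P + + β * T - (y * + P + + β * T'))
        ≡⟨ cong (λ w → (y - x) * + P + (w - (y * + P + + β * T'))) eq ⟩
      (y - x) * + P + (y * + P + + β * T' - (y * + P + + β * T'))
        ≡⟨ drop ((y - x) * + P) (y * + P + + β * T') ⟩
      (y - x) * + P ∎
      where
      isolate : ∀ x y T T' P β → β * (T - T') ≡ (y - x) * P + (x * P + β * T - (y * P + β * T'))
      isolate = solve-∀
      drop : ∀ a z → a + (z - z) ≡ a
      drop = solve-∀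
    y≡x+qβ : y ≡ x + q * + β
    y≡x+qβ = sym (begin
      x + q * + β                                           ≡⟨ spread x u (T - T') (y - x) v (+ β) ⟩
      x + u * (+ β * (T - T')) + (y - x) * v * + β          ≡⟨ cong (λ w → x + u * w + (y - x) * v * + β) βe≡dP ⟩
      x + u * ((y - x) * + P) + (y - x) * v * + β           ≡⟨ gather x u (y - x) v (+ P) (+ β) ⟩
      x + (y - x) * (u * + P + v * + β)                     ≡⟨ cong (λ w → x + (y - x) * w) uP+vβ≡1 ⟩
      x + (y - x) * + 1                                     ≡⟨ telescope x y ⟩
      y                                                     ∎)
      where
      spread : ∀ x u e d v β → x + (u * e + d * v) * β ≡ x + u * (β * e) + d * v * β
      spread = solve-∀
      gather : ∀ x u d v P β → x + u * (d * P) + d * v * β ≡ x + d * (u * P + v * β)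
      gather = solve-∀
      telescope : ∀ x y → x + (y - x) * + 1 ≡ y
      telescope = solve-∀
    T≡T'+qP : T ≡ T' + q * + P
    T≡T'+qP = ℤ.*-cancelˡ-≡ (+ β) T (T' + q * + P) (sym (begin
      + β * (T' + q * + P)              ≡⟨ distribute x (+ β) T' q (+ P) ⟩
      + β * T' + (x + q * + β - x) * + P ≡⟨ cong (λ w → + β * T' + (w - x) * + P) y≡x+qβ ⟨
      + β * T' + (y - x) * + P          ≡⟨ cong (_+_ (+ β * T')) βe≡dP ⟨
      + β * T' + + β * (T - T')         ≡⟨ collapse (+ β) T T' ⟩
      + β * T                           ∎))
      where
      distribute : ∀ x β T' q P → β * (T' + q * P) ≡ β * T' + (x + q * β - x) * P
      distribute = solve-∀
      collapse : ∀ β T T' → β * T' + β * (T - T') ≡ β * T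
      collapse = solve-∀

  digit-unique : ∀ x y T T' → Bounded β x → Bounded β y →
                 x * + P + + β * T ≡ y * + P + + β * T' → (x ≡ y) × (T ≡ T')
  digit-unique x y T T' (0≤x , x<β) (0≤y , y<β) eq =
    sym (trans y≡x+qβ (no-carry x (+ β))) , trans T≡T'+qP (no-carry T' (+ P))
    where
    carried = carry {x} {y} {T} {T'} eq
    q = proj₁ carried
    y≡x+qβ = proj₁ (proj₂ carried)
    T≡T'+qP = proj₂ (proj₂ carried)
    reverse : ∀ x q β → x ≡ (x + q * β) + (- q) * β
    reverse = solve-∀
    q≡0 : q ≡ + 0
    q≡0 = nonneg-antisym q (carry-nonneg q 0≤y x<β y≡x+qβ)
            (carry-nonneg (- q) 0≤x y<β (trans (reverse x q (+ β)) (cong (λ w → w + (- q) * + β) (sym y≡x+qβ))))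
    no-carry : ∀ z w → z + q * w ≡ z
    no-carry z w = trans (cong (λ p → z + p * w) q≡0) (ℤ.+-identityʳ z)

  digit-carry : ∀ x y T T' → x < + β → + 0 ≤ y →
                x * + P + + β * T ≡ y * + P + + β * T' → Σ ℕ λ q → T ≡ T' + + q * + P
  digit-carry x y T T' x<β 0≤y eq =
    ∣ q ∣ , trans T≡T'+qP (cong (λ w → T' + w * + P) (sym (ℤ.0≤i⇒+∣i∣≡i (carry-nonneg q 0≤y x<β y≡x+qβ))))
    where
    carried = carry {x} {y} {T} {T'} eq
    q = proj₁ carried
    y≡x+qβ = proj₁ (proj₂ carried)
    T≡T'+qP = proj₂ (proj₂ carried)

Representableℤ : (Fin m → ℕ) → ℤ → Set
Representableℤ g n = Σ (Fin _ → ℕ) λ μ → n ≡ sumℤ (λ i → + μ i * + g i)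

representable⇒nonneg : ∀ {n} (g : Fin m → ℕ) → Representableℤ g n → + 0 ≤ n
representable⇒nonneg g (μ , n≡) =
  subst (+ 0 ≤_) (sym n≡) (sumℤ-nonneg _ λ i → subst (+ 0 ≤_) (ℤ.pos-* (μ i) (g i)) (+≤+ z≤n))

nonneg⇒representable : ∀ {n} (g : Fin m → ℕ) (c : Fin m → ℤ) →
  (∀ i → + 0 ≤ c i) → Expresses g c n → Representableℤ g n
nonneg⇒representable g c c≥0 n≡ =
  (λ i → ∣ c i ∣) , trans n≡ (sumℤ-cong λ i → cong (_* + g i) (sym (ℤ.0≤i⇒+∣i∣≡i (c≥0 i))))

sumℤ-updateAt : (μ g : Fin m → ℕ) (e : Fin m) (r : ℕ) →
  sumℤ (λ i → + updateAt μ e (ℕ._+ r) i * + g i) ≡ sumℤ (λ i → + μ i * + g i) + + r * + g e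
sumℤ-updateAt {suc m} μ g fzero r =
  trans (cong (λ w → w * + g fzero + rest) (ℤ.pos-+ (μ fzero) r)) (shift (+ μ fzero) (+ r) (+ g fzero) rest)
  where
  rest = sumℤ (λ i → + μ (fsuc i) * + g (fsuc i))
  shift : ∀ x r g s → (x + r) * g + s ≡ x * g + s + r * g
  shift = solve-∀
sumℤ-updateAt {suc m} μ g (fsuc e) r =
  trans (cong (_+_ (+ μ fzero * + g fzero)) (sumℤ-updateAt (μ ∘ fsuc) (g ∘ fsuc) e r))
        (sym (ℤ.+-assoc (+ μ fzero * + g fzero) _ _))

representable-+-multiple : ∀ {T} (g : Fin m → ℕ) → Representableℤ g T →
  ∀ e s q → Representableℤ g (T + + q * + (s ℕ.* g e))
representable-+-multiple {T = T} g (μ , T≡) e s q =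
  updateAt μ e (ℕ._+ (q ℕ.* s)) , (begin
    T + + q * + (s ℕ.* g e)                 ≡⟨ cong (_+_ T) (regroup q s (g e)) ⟩
    T + + (q ℕ.* s) * + g e                 ≡⟨ cong (_+ + (q ℕ.* s) * + g e) T≡ ⟩
    sumℤ (λ i → + μ i * + g i) + + (q ℕ.* s) * + g e ≡⟨ sumℤ-updateAt μ g e (q ℕ.* s) ⟨
    sumℤ (λ i → + updateAt μ e (ℕ._+ (q ℕ.* s)) i * + g i) ∎)
  where
  open ≡-Reasoning
  regroup : ∀ q s h → + q * + (s ℕ.* h) ≡ + (q ℕ.* s) * + h
  regroup q s h = begin
    + q * + (s ℕ.* h)   ≡⟨ ℤ.pos-* q (s ℕ.* h) ⟨
    + (q ℕ.* (s ℕ.* h)) ≡⟨ cong +_ (ℕ.*-assoc q s h) ⟨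
    + (q ℕ.* s ℕ.* h)   ≡⟨ ℤ.pos-* (q ℕ.* s) h ⟩
    + (q ℕ.* s) * + h   ∎

data InitOrLast : {m : ℕ} → Fin (suc m) → Set where
  init : (i : Fin m) → InitOrLast (inject₁ i)
  last : InitOrLast (fromℕ m)

initOrLast : (i : Fin (suc m)) → InitOrLast i
initOrLast {zero}  fzero    = last
initOrLast {suc m} fzero    = init fzero
initOrLast {suc m} (fsuc i) with initOrLast i
... | init j = init (fsuc j)
... | last   = last

insertAt-last-inject₁ : (f : Fin m → ℤ) (x : ℤ) (i : Fin m) → insertAt f (fromℕ m) x (inject₁ i) ≡ f i
insertAt-last-inject₁ {suc m} f x fzero    = refl
insertAt-last-inject₁ {suc m} f x (fsuc i) = insertAt-last-inject₁ (f ∘ fsuc) x i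

module _ {a b : Fin (suc k) → ℕ} where

  normalized-∷ : ∀ {j x c} → Bounded (b fzero) x →
    Normalized (a ∘ fsuc) (b ∘ fsuc) j c → Normalized a b (fsuc j) (x ∷ c)
  normalized-∷ {j} {x} {c} x-bounded (below , above) = below′ , above′
    where
    below′ : ∀ t → toℕ t ℕ.< suc (toℕ j) → Bounded (b t) ((x ∷ c) (inject₁ t))
    below′ fzero    _         = x-bounded
    below′ (fsuc t) (s≤s t<j) = below t t<j
    above′ : ∀ t → suc (toℕ j) ℕ.≤ toℕ t → Bounded (a t) (c t)
    above′ (fsuc t) (s≤s j≤t) = above t j≤t

  normalized-tail : ∀ {j c} → Normalized a b (fsuc j) c →
    Bounded (b fzero) (c fzero) × Normalized (a ∘ fsuc) (b ∘ fsuc) j (c ∘ fsuc)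
  normalized-tail (below , above) =
    below fzero (s≤s z≤n) , (λ t t<j → below (fsuc t) (s≤s t<j)) , (λ t j≤t → above (fsuc t) (s≤s j≤t))

  normalized-insertAt-last : ∀ {c x} → Normalized (a ∘ inject₁) (b ∘ inject₁) fzero c →
    Bounded (a (fromℕ k)) x → Normalized a b fzero (insertAt c (fromℕ (suc k)) x)
  normalized-insertAt-last {c} {x} (_ , above) x-bounded = (λ _ ()) , λ t _ → bounded t (initOrLast t)
    where
    bounded : ∀ t → InitOrLast t → Bounded (a t) (insertAt c (fromℕ (suc k)) x (fsuc t))
    bounded _ (init t) = subst (Bounded (a (inject₁ t))) (sym (insertAt-last-inject₁ c x (fsuc t))) (above t z≤n)
    bounded _ last     = subst (Bounded (a (fromℕ k))) (sym (insertAt-lookup c (fromℕ (suc k)) x)) x-bounded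

  normalized-init : ∀ {c} → Normalized a b fzero c →
    Bounded (a (fromℕ k)) (c (fromℕ (suc k))) × Normalized (a ∘ inject₁) (b ∘ inject₁) fzero (c ∘ inject₁)
  normalized-init (_ , above) = above (fromℕ k) z≤n , (λ _ ()) , λ t _ → above (inject₁ t) z≤n

normalized-nonneg : ∀ {a b : Fin k → ℕ} {j c} → Normalized a b j c → + 0 ≤ c j → ∀ i → + 0 ≤ c i
normalized-nonneg {k} {j = j} {c} (below , above) 0≤cj i with ℕ.<-cmp (toℕ i) (toℕ j)
... | tri≈ _ i≡j _ = subst (λ i → + 0 ≤ c i) (sym (Fin.toℕ-injective i≡j)) 0≤cj
... | tri< i<j _ _ = below-j i (initOrLast i) i<j
  where
  below-j : ∀ i → InitOrLast i → toℕ i ℕ.< toℕ j → + 0 ≤ c i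
  below-j _ (init t) t<j = proj₁ (below t (subst (ℕ._< toℕ j) (Fin.toℕ-inject₁ t) t<j))
  below-j _ last     k<j = contradiction (Fin.≤fromℕ j) (ℕ.<⇒≱ k<j)
... | tri> _ _ j<i = above-j i j<i
  where
  above-j : ∀ i → toℕ j ℕ.< toℕ i → + 0 ≤ c i
  above-j (fsuc t) (s≤s j≤t) = proj₁ (above t j≤t)

record Decomposition (a b : Fin k → ℕ) (j : Fin (suc k)) (n : ℤ) : Set where
  field
    coeff      : Fin (suc k) → ℤ
    normalized : Normalized a b j coeff
    expresses  : Expresses (compound a b) coeff n
    unique     : ∀ c → Normalized a b j c → Expresses (compound a b) c n → ∀ i → c i ≡ coeff i
    nonneg     : Representableℤ (compound a b) n → + 0 ≤ coeff j

decomposition-base : (a b : Fin 0 → ℕ) (n : ℤ) → Decomposition a b fzero n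
decomposition-base a b n = record
  { coeff      = λ _ → n
  ; normalized = (λ ()) , (λ ())
  ; expresses  = sym (times-one n)
  ; unique     = λ { c _ n≡ fzero → sym (trans n≡ (times-one (c fzero))) }
  ; nonneg     = representable⇒nonneg (compound a b)
  }
  where
  times-one : ∀ x → x * + 1 + + 0 ≡ x
  times-one x = trans (ℤ.+-identityʳ _) (ℤ.*-identityʳ x)

decomposition-suc : (a b : Fin (suc k) → ℕ) → Positive b → Suitable a b → ∀ j n →
  (∀ n′ → Decomposition (a ∘ fsuc) (b ∘ fsuc) j n′) → Decomposition a b (fsuc j) n
decomposition-suc a b b>0 suitable j n rest = record
  { coeff      = + digit ∷ coeff
  ; normalized = normalized-∷ digit-bounded normalized
  ; expresses  = trans split (trans (cong (_+_ (+ digit * + P) ∘ (+ β *_)) expresses)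
                                    (sym (sumℤ-compound-head a b (+ digit ∷ coeff))))
  ; unique     = unique′
  ; nonneg     = nonneg′
  }
  where
  β = b fzero
  P = prodℕ a
  instance _ = ℕ.>-nonZero (b>0 fzero)
  open Digits P β (coprime-prodℕ a λ t → suitable t fzero z≤n)
  open DigitSplit (digitSplit n)
  open Decomposition (rest quotient)
  digit-bounded : Bounded β (+ digit)
  digit-bounded = +≤+ z≤n , +<+ digit<β
  rewrite-split : ∀ c → Expresses (compound a b) c n →
    + digit * + P + + β * quotient
      ≡ c fzero * + P + + β * sumℤ (λ i → c (fsuc i) * + compound (a ∘ fsuc) (b ∘ fsuc) i)
  rewrite-split c n≡ = trans (sym split) (trans n≡ (sumℤ-compound-head a b c))
  unique′ : ∀ c → Normalized a b (fsuc j) c → Expresses (compound a b) c n → ∀ i → c i ≡ (+ digit ∷ coeff) i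
  unique′ c c-normalized n≡ = λ where
      fzero    → sym (proj₁ same)
      (fsuc i) → unique (c ∘ fsuc) (proj₂ parts) (proj₂ same) i
    where
    parts = normalized-tail {c = c} c-normalized
    same  = digit-unique (+ digit) (c fzero) quotient _ digit-bounded (proj₁ parts) (rewrite-split c n≡)
  nonneg′ : Representableℤ (compound a b) n → + 0 ≤ coeff j
  nonneg′ (μ , n≡) = nonneg (subst (Representableℤ g′) (sym quotient≡) representable)
    where
    g′ = compound (a ∘ fsuc) (b ∘ fsuc)
    carried : Σ ℕ λ q → quotient ≡ sumℤ (λ i → + μ (fsuc i) * + g′ i) + + q * + P
    carried = digit-carry (+ digit) (+ μ fzero) quotient _ (+<+ digit<β) (+≤+ z≤n) (rewrite-split (λ i → + μ i) n≡)
    quotient≡ = proj₂ carried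
    representable = representable-+-multiple g′ (μ ∘ fsuc , refl) fzero (a fzero) (proj₁ carried)

decomposition-zero : (a b : Fin (suc k) → ℕ) → Positive a → Suitable a b → ∀ n →
  (∀ n′ → Decomposition (a ∘ inject₁) (b ∘ inject₁) fzero n′) → Decomposition a b fzero n
decomposition-zero {k} a b a>0 suitable n rest = record
  { coeff      = coeff′
  ; normalized = normalized-insertAt-last normalized digit-bounded
  ; expresses  = trans split (trans (cong₂ (λ x T → x * + P + + β * T) (sym coeff′-last)
                                           (trans expresses (sumℤ-cong λ i → cong (_* + g″ i) (sym (coeff′-init i)))))
                                    (sym (sumℤ-compound-last a b coeff′)))
  ; unique     = unique′
  ; nonneg     = nonneg′
  }
  where
  β = a (fromℕ k)
  P = prodℕ b
  g″ = compound (a ∘ inject₁) (b ∘ inject₁)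
  instance _ = ℕ.>-nonZero (a>0 (fromℕ k))
  open Digits P β (coprime-prodℕ b λ t → coprime-sym (suitable (fromℕ k) t (Fin.≤fromℕ t)))
  open DigitSplit (digitSplit n)
  open Decomposition (rest quotient)
  coeff′ = insertAt coeff (fromℕ (suc k)) (+ digit)
  coeff′-last : coeff′ (fromℕ (suc k)) ≡ + digit
  coeff′-last = insertAt-lookup coeff (fromℕ (suc k)) (+ digit)
  coeff′-init : ∀ i → coeff′ (inject₁ i) ≡ coeff i
  coeff′-init = insertAt-last-inject₁ coeff (+ digit)
  digit-bounded : Bounded β (+ digit)
  digit-bounded = +≤+ z≤n , +<+ digit<β
  rewrite-split : ∀ c → Expresses (compound a b) c n →
    + digit * + P + + β * quotient ≡ c (fromℕ (suc k)) * + P + + β * sumℤ (λ i → c (inject₁ i) * + g″ i)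
  rewrite-split c n≡ = trans (sym split) (trans n≡ (sumℤ-compound-last a b c))
  unique′ : ∀ c → Normalized a b fzero c → Expresses (compound a b) c n → ∀ i → c i ≡ coeff′ i
  unique′ c c-normalized n≡ i = pick i (initOrLast i)
    where
    parts = normalized-init {c = c} c-normalized
    same  = digit-unique (+ digit) (c (fromℕ (suc k))) quotient _ digit-bounded (proj₁ parts) (rewrite-split c n≡)
    pick : ∀ i → InitOrLast i → c i ≡ coeff′ i
    pick _ (init i) = trans (unique (c ∘ inject₁) (proj₂ parts) (proj₂ same) i) (sym (coeff′-init i))
    pick _ last     = trans (sym (proj₁ same)) (sym coeff′-last)
  nonneg′ : Representableℤ (compound a b) n → + 0 ≤ coeff fzero
  nonneg′ (μ , n≡) = nonneg (subst (Representableℤ g″) (sym (proj₂ carried)) representable)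
    where
    T = sumℤ (λ i → + μ (inject₁ i) * + g″ i)
    carried : Σ ℕ λ q → quotient ≡ T + + q * + P
    carried = digit-carry (+ digit) (+ μ (fromℕ (suc k))) quotient T (+<+ digit<β) (+≤+ z≤n)
                          (rewrite-split (λ i → + μ i) n≡)
    q = proj₁ carried
    representable : Representableℤ g″ (T + + q * + P)
    representable = subst (λ m → Representableℤ g″ (T + + q * + m)) (sym (prodℕ-last-factor a b))
                          (representable-+-multiple g″ (μ ∘ inject₁ , refl) (fromℕ k) (b (fromℕ k)) q)

suitable-tail : {a b : Fin (suc k) → ℕ} → Suitable a b → Suitable (a ∘ fsuc) (b ∘ fsuc)
suitable-tail suitable i j j≤i = suitable (fsuc i) (fsuc j) (s≤s j≤i)

suitable-init : {a b : Fin (suc k) → ℕ} → Suitable a b → Suitable (a ∘ inject₁) (b ∘ inject₁)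
suitable-init suitable i j j≤i =
  suitable (inject₁ i) (inject₁ j) (subst₂ ℕ._≤_ (sym (Fin.toℕ-inject₁ j)) (sym (Fin.toℕ-inject₁ i)) j≤i)

decomposition : ∀ k (a b : Fin k → ℕ) → Positive a → Positive b → Suitable a b →
                ∀ j n → Decomposition a b j n
decomposition zero    a b _   _   _        fzero    n = decomposition-base a b n
decomposition (suc k) a b a>0 b>0 suitable fzero    n =
  decomposition-zero a b a>0 suitable n
    (decomposition k (a ∘ inject₁) (b ∘ inject₁) (a>0 ∘ inject₁) (b>0 ∘ inject₁) (suitable-init suitable) fzero)
decomposition (suc k) a b a>0 b>0 suitable (fsuc j) n =
  decomposition-suc a b b>0 suitable j n
    (decomposition k (a ∘ fsuc) (b ∘ fsuc) (a>0 ∘ fsuc) (b>0 ∘ fsuc) (suitable-tail suitable) j)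

≱0⇒1≤- : ∀ {i} → ¬ (+ 0 ≤ i) → + 1 ≤ - i
≱0⇒1≤- {+ _}      i≱0 = contradiction (+≤+ z≤n) i≱0
≱0⇒1≤- { -[1+ _ ]} _   = +≤+ (s≤s z≤n)

1≤-⇒≱0 : ∀ {i} → + 1 ≤ - i → ¬ (+ 0 ≤ i)
1≤-⇒≱0 {+ zero}  (+≤+ ())
1≤-⇒≱0 {+ suc _} ()

private
  rearrange : ∀ i j k → k - (- i * j) ≡ i * j + k
  rearrange = solve-∀

0≤i*j+k⇒-i*j≤k : ∀ i j k → + 0 ≤ i * j + k → - i * j ≤ k
0≤i*j+k⇒-i*j≤k i j k 0≤ = ℤ.0≤i-j⇒j≤i (subst (+ 0 ≤_) (sym (rearrange i j k)) 0≤)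

-i*j≤k⇒0≤i*j+k : ∀ i j k → - i * j ≤ k → + 0 ≤ i * j + k
-i*j≤k⇒0≤i*j+k i j k ≤k = subst (+ 0 ≤_) (rearrange i j k) (ℤ.i≤j⇒0≤j-i ≤k)

lemma3p1 : (k : ℕ) (a b : Fin k → ℕ) → Positive a → Positive b → Suitable a b →
           (n : ℤ) (j : Fin (suc k)) →
           Σ (Fin (suc k) → ℤ) λ c →
             Normalized a b j c × Expresses (compound a b) c n
             × (∀ c′ → Normalized a b j c′ → Expresses (compound a b) c′ n → ∀ i → c′ i ≡ c i)
             × (NR a b n ⇔ ((+ 1 ≤ - c j) × ((- c j) * + compound a b j ≤ sumExcept (compound a b) c j)))
lemma3p1 k a b a>0 b>0 suitable n j = coeff , normalized , expresses , unique , mk⇔ nr⇒bounds bounds⇒nr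
  where
  open Decomposition (decomposition k a b a>0 b>0 suitable j n)
  g = compound a b
  S = sumExcept g coeff j
  n≡ : n ≡ coeff j * + g j + S
  n≡ = trans expresses (sumℤ-remove (λ i → coeff i * + g i) j)
  nr⇒bounds : NR a b n → (+ 1 ≤ - coeff j) × ((- coeff j) * + g j ≤ S)
  nr⇒bounds (m , n≡m , unrepresentable) with + 0 ℤ.≤? coeff j
  ... | yes 0≤cj = contradiction (subst (Representableℤ g) n≡m representable) unrepresentable
    where representable = nonneg⇒representable g coeff (normalized-nonneg normalized 0≤cj) expresses
  ... | no  cj≱0 =
    ≱0⇒1≤- cj≱0 , 0≤i*j+k⇒-i*j≤k (coeff j) (+ g j) S (subst (+ 0 ≤_) (trans (sym n≡m) n≡) (+≤+ z≤n))
  bounds⇒nr : (+ 1 ≤ - coeff j) × ((- coeff j) * + g j ≤ S) → NR a b n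
  bounds⇒nr (1≤-cj , -cjgj≤S) =
    ∣ n ∣ , sym +∣n∣≡n ,
    λ representable → 1≤-⇒≱0 1≤-cj (nonneg (subst (Representableℤ g) +∣n∣≡n representable))
    where
    +∣n∣≡n = ℤ.0≤i⇒+∣i∣≡i (subst (+ 0 ≤_) (sym n≡) (-i*j≤k⇒0≤i*j+k (coeff j) (+ g j) S -cjgj≤S))
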